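{- Let $S,T$ be nonempty subsets of $[n-1]$ such that $T_n\langle S;T\rangle$ is walk-ensured, let $D$ be its digraph, and let $d=\gcd(S\cup T)$. If vertices $u,v\in[n]$ satisfy $u\equiv v\pmod d$, then there is a directed walk from $u$ to $v$ in $D$.
   Context: For nonempty $S,T\subseteq[n-1]$, $T_n\langle S;T\rangle$ denotes the $n\times n$ $(0,1)$-matrix whose $(i,j)$-entry is $1$ if and only if $j-i\in S$ or $i-j\in T$. Its digraph has vertex set $[n]$ and an arc $(i,j)$ exactly when the $(i,j)$-entry is $1$. $\gcd(S\cup T)$ is the gcd of all elements of $S\cup T$; $\gcd(S+T)=\gcd\{s+t: s\in S,t\in T\}$; $s_1=\min S$. The matrix is called walk-ensured if there is a positive integer $M$ such that for all vertices $u,v\in[n]$ and every integer $\ell\ge M$ with $v-u\equiv \ell s_1 \pmod{\gcd(S+T)}$, there is a directed walk from $u$ to $v$ of length $\ell$ in its digraph. -}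

module Defs where

open import Data.Nat using (ℕ; zero; suc; _+_; _*_; _≤_; _⊓_)
open import Data.Nat.GCD using (gcd)
open import Data.List using (List; []; _∷_; foldr; concatMap; map)
open import Data.List.Membership.Propositional using (_∈_)
open import Data.List.Relation.Unary.All using (All)
open import Data.Product using (Σ; ∃; _×_; _,_)
open import Data.Sum using (_⊎_)
open import Data.Integer as ℤ using (ℤ; +_)
open import Data.Integer.Divisibility as ℤD using ()
open import Relation.Binary.PropositionalEquality using (_≡_)

-- Finite subsets of ℕ are represented by lists (duplicates harmless).

-- gcd of all elements of a list (gcd of the empty list is 0)
gcdList : List ℕ → ℕ
gcdList = foldr gcd 0

-- minimum of a list (only meaningful for nonempty lists; [] ↦ 0)
minList : List ℕ → ℕ
minList []       = 0
minList (x ∷ xs) = foldr _⊓_ x xs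

sumSet : List ℕ → List ℕ → List ℕ
sumSet S T = concatMap (λ s → map (λ t → s + t) T) S

NonemptySubsetOfBelow : ℕ → List ℕ → Set
NonemptySubsetOfBelow n S = (∃ λ s → s ∈ S) × All (λ s → 1 ≤ s × suc s ≤ n) S

Vertex : ℕ → ℕ → Set
Vertex n u = 1 ≤ u × u ≤ n

Arc : ℕ → List ℕ → List ℕ → ℕ → ℕ → Set
Arc n S T i j = Vertex n i × Vertex n j ×
  ((∃ λ s → s ∈ S × j ≡ i + s) ⊎ (∃ λ t → t ∈ T × i ≡ j + t))

data Walk (n : ℕ) (S T : List ℕ) : ℕ → ℕ → ℕ → Set where
  here : ∀ {u} → Vertex n u → Walk n S T u u 0
  step : ∀ {u w v ℓ} → Arc n S T u w → Walk n S T w v ℓ → Walk n S T u v (suc ℓ)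

_≡_[mod_] : ℤ → ℤ → ℕ → Set
a ≡ b [mod m ] = (+ m) ℤD.∣ (a ℤ.- b)

WalkEnsured : ℕ → List ℕ → List ℕ → Set
WalkEnsured n S T = ∃ λ M → 1 ≤ M ×
  (∀ u v ℓ → Vertex n u → Vertex n v → M ≤ ℓ →
     (+ v ℤ.- + u) ≡ + (ℓ * minList S) [mod gcdList (sumSet S T) ] →
     Walk n S T u v ℓ)

gcdUnion : List ℕ → List ℕ → ℕ
gcdUnion S T = gcd (gcdList S) (gcdList T)

-- Let s₁ = min S and g = gcd(S + T), which is positive since g ∣ s₁ + t₀.
-- A common divisor of s₁ and g divides every t ∈ T (because g ∣ s₁ + t)
-- and then every s ∈ S (because g ∣ s + t₀); so gcd(s₁, g) divides
-- d = gcd(S ∪ T), hence divides v − u.  By Bézout the congruence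
-- ℓ s₁ ≡ v − u (mod g) is then solvable, with ℓ as large as we like, and
-- walk-ensuredness turns such an ℓ ≥ M into a walk from u to v.
module Submission where

open import Defs
open import Data.Nat using (ℕ)
open import Data.List using (List)
open import Data.Product using (∃)
open import Data.Integer using (+_)

open import Data.Nat as ℕ using (_≤_; NonZero; ≢-nonZero; ≢-nonZero⁻¹; >-nonZero)
import Data.Nat.Properties as ℕ
open import Data.Nat.Divisibility as ℕ using (_∣_; ∣-trans; _∣0; 0∣⇒≡0; ∣m+n∣m⇒∣n)
open import Data.Nat.GCD using (gcd; gcd-GCD; gcd[m,n]∣m; gcd[m,n]∣n; gcd-greatest; module Bézout)
open import Data.List using (_∷_)
open import Data.List.Membership.Propositional using (_∈_)
open import Data.List.Membership.Propositional.Properties using (∈-map⁺; ∈-concatMap⁺; foldr-selective)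
open import Data.List.Relation.Unary.Any as Any using (here; there)
open import Data.List.Relation.Unary.All as All using (All; []; _∷_)
open import Data.Product using (_,_; _×_; proj₁; ∃₂)
open import Data.Sum using (inj₁; inj₂)
open import Data.Integer as ℤ using (_+_; _*_; _-_; -_)
import Data.Integer.Properties as ℤ
open import Data.Integer.DivMod using (_%ℕ_; _/ℕ_; a≡a%ℕn+[a/ℕn]*n)
open import Data.Integer.Divisibility.Signed as ℤ using (divides; ∣ᵤ⇒∣; ∣⇒∣ᵤ; ∣m∣n⇒∣m-n; ∣m⇒∣m*n)
open import Data.Integer.Tactic.RingSolver using (solve-∀)
open import Relation.Binary.PropositionalEquality using (_≡_; refl; trans; cong; cong₂; subst; module ≡-Reasoning)

minList-∈ : ∀ {s S} → s ∈ S → minList S ∈ S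
minList-∈ {S = x ∷ xs} _ with foldr-selective ℕ.⊓-sel x xs
... | inj₁ min≡x  = here min≡x
... | inj₂ min∈xs = there min∈xs

∈-sumSet : ∀ {s t S T} → s ∈ S → t ∈ T → s ℕ.+ t ∈ sumSet S T
∈-sumSet {s} s∈S t∈T = ∈-concatMap⁺ _ (Any.map (λ { refl → ∈-map⁺ (s ℕ.+_) t∈T }) s∈S)

gcdList-∣ : ∀ {x xs} → x ∈ xs → gcdList xs ∣ x
gcdList-∣ {xs = y ∷ ys} (here refl) = gcd[m,n]∣m y (gcdList ys)
gcdList-∣ {xs = y ∷ ys} (there x∈ys) = ∣-trans (gcd[m,n]∣n y (gcdList ys)) (gcdList-∣ x∈ys)

∣-gcdList : ∀ {k xs} → All (k ∣_) xs → k ∣ gcdList xs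
∣-gcdList []           = _ ∣0
∣-gcdList (k∣y ∷ k∣ys) = gcd-greatest k∣y (∣-gcdList k∣ys)

gcdList-nonZero : ∀ {x xs} → x ∈ xs → .{{NonZero x}} → NonZero (gcdList xs)
gcdList-nonZero {x} x∈xs = ≢-nonZero λ gcd≡0 →
  ≢-nonZero⁻¹ x (0∣⇒≡0 (subst (_∣ x) gcd≡0 (gcdList-∣ x∈xs)))

∣s∧∣gcd[S+T]⇒∣gcdUnion : ∀ {e s₀ t₀ S T} → s₀ ∈ S → t₀ ∈ T →
  e ∣ s₀ → e ∣ gcdList (sumSet S T) → e ∣ gcdUnion S T
∣s∧∣gcd[S+T]⇒∣gcdUnion {e} {s₀} {t₀} {S} {T} s₀∈S t₀∈T e∣s₀ e∣g =
  gcd-greatest (∣-gcdList (All.tabulate e∣S)) (∣-gcdList (All.tabulate e∣T))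
  where
  e∣sum : ∀ {s t} → s ∈ S → t ∈ T → e ∣ s ℕ.+ t
  e∣sum s∈S t∈T = ∣-trans e∣g (gcdList-∣ (∈-sumSet s∈S t∈T))

  e∣T : ∀ {t} → t ∈ T → e ∣ t
  e∣T t∈T = ∣m+n∣m⇒∣n (e∣sum s₀∈S t∈T) e∣s₀

  e∣S : ∀ {s} → s ∈ S → e ∣ s
  e∣S {s} s∈S = ∣m+n∣m⇒∣n (subst (e ∣_) (ℕ.+-comm s t₀) (e∣sum s∈S t₀∈T)) (e∣T t₀∈T)

≡-mod-sym : ∀ a b {m} → a ≡ b [mod m ] → b ≡ a [mod m ]
≡-mod-sym a b {m} = subst (m ∣_) (ℤ.∣i-j∣≡∣j-i∣ a b)

≡-mod-∣ : ∀ a b {k m} → k ∣ m → a ≡ b [mod m ] → a ≡ b [mod k ]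
≡-mod-∣ _ _ = ∣-trans

pos-+-* : ∀ d p q → + (d ℕ.+ p ℕ.* q) ≡ + d + + p * + q
pos-+-* d p q = trans (ℤ.pos-+ d (p ℕ.* q)) (cong (λ pq → + d + pq) (ℤ.pos-* p q))

bézout : ∀ a b → ∃₂ λ α β → + gcd a b ≡ α * + a + β * + b
bézout a b with Bézout.identity (gcd-GCD a b)
... | Bézout.+- x y eq = + x , - + y , (begin
  + gcd a b                               ≡⟨ add-sub (+ gcd a b) (+ y) (+ b) ⟩
  (+ gcd a b + + y * + b) + - + y * + b   ≡⟨ cong (λ r → r + - + y * + b) (pos-+-* (gcd a b) y b) ⟨
  + (gcd a b ℕ.+ y ℕ.* b) + - + y * + b   ≡⟨ cong (λ r → + r + - + y * + b) eq ⟩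
  + (x ℕ.* a) + - + y * + b               ≡⟨ cong (λ r → r + - + y * + b) (ℤ.pos-* x a) ⟩
  + x * + a + - + y * + b                 ∎)
  where
  open ≡-Reasoning
  add-sub : ∀ d y b → d ≡ (d + y * b) + - y * b
  add-sub = solve-∀
... | Bézout.-+ x y eq = - + x , + y , (begin
  + gcd a b                               ≡⟨ sub-add (+ gcd a b) (+ x) (+ a) ⟩
  - + x * + a + (+ gcd a b + + x * + a)   ≡⟨ cong (λ r → - + x * + a + r) (pos-+-* (gcd a b) x a) ⟨
  - + x * + a + + (gcd a b ℕ.+ x ℕ.* a)   ≡⟨ cong (λ r → - + x * + a + + r) eq ⟩
  - + x * + a + + (y ℕ.* b)               ≡⟨ cong (λ r → - + x * + a + r) (ℤ.pos-* y b) ⟩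
  - + x * + a + + y * + b                 ∎)
  where
  open ≡-Reasoning
  sub-add : ∀ d x a → d ≡ - x * a + (d + x * a)
  sub-add = solve-∀

gcd∣⇒≡-multiple-mod : ∀ a g {z} → + gcd a g ℤ.∣ z → ∃ λ L → + g ℤ.∣ z - L * + a
gcd∣⇒≡-multiple-mod a g {z} (divides q z≡q*gcd) with bézout a g
... | α , β , gcd≡αa+βg = q * α , divides (q * β) (begin
  z - q * α * + a                        ≡⟨ cong (λ r → r - q * α * + a) z≡q*gcd ⟩
  q * + gcd a g - q * α * + a            ≡⟨ cong (λ r → q * r - q * α * + a) gcd≡αa+βg ⟩
  q * (α * + a + β * + g) - q * α * + a  ≡⟨ expand q α β (+ a) (+ g) ⟩
  q * β * + g                            ∎)
  where
  open ≡-Reasoning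
  expand : ∀ q α β a g → q * (α * a + β * g) - q * α * a ≡ q * β * g
  expand = solve-∀

∃-≥-≡-mod : ∀ g .{{_ : NonZero g}} M L → ∃ λ ℓ → M ≤ ℓ × + g ℤ.∣ + ℓ - L
∃-≥-≡-mod g M L = L %ℕ g ℕ.+ M ℕ.* g
                , ℕ.≤-trans (ℕ.m≤m*n M g) (ℕ.m≤n+m (M ℕ.* g) (L %ℕ g))
                , divides (+ M - L /ℕ g) (begin
  + (L %ℕ g ℕ.+ M ℕ.* g) - L                               ≡⟨ cong₂ _-_ (pos-+-* (L %ℕ g) M g) (a≡a%ℕn+[a/ℕn]*n L g) ⟩
  (+ (L %ℕ g) + + M * + g) - (+ (L %ℕ g) + L /ℕ g * + g)   ≡⟨ cancel (+ (L %ℕ g)) (+ M) (L /ℕ g) (+ g) ⟩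
  (+ M - L /ℕ g) * + g                                     ∎)
  where
  open ≡-Reasoning
  cancel : ∀ r m q g → (r + m * g) - (r + q * g) ≡ (m - q) * g
  cancel = solve-∀

≡-multiple-mod-trans : ∀ {g a ℓ} z L → + g ℤ.∣ z - L * + a → + g ℤ.∣ + ℓ - L →
  z ≡ + (ℓ ℕ.* a) [mod g ]
≡-multiple-mod-trans {g} {a} {ℓ} z L g∣z-La g∣ℓ-L =
  ∣⇒∣ᵤ (subst (+ g ℤ.∣_) regroup (∣m∣n⇒∣m-n g∣z-La (∣m⇒∣m*n (+ a) g∣ℓ-L)))
  where
  open ≡-Reasoning
  sub-sub : ∀ z L ℓ a → (z - L * a) - (ℓ - L) * a ≡ z - ℓ * a
  sub-sub = solve-∀
  regroup : (z - L * + a) - (+ ℓ - L) * + a ≡ z - + (ℓ ℕ.* a)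
  regroup = begin
    (z - L * + a) - (+ ℓ - L) * + a   ≡⟨ sub-sub z L (+ ℓ) (+ a) ⟩
    z - + ℓ * + a                     ≡⟨ cong (λ r → z - r) (ℤ.pos-* ℓ a) ⟨
    z - + (ℓ ℕ.* a)                   ∎

linear-congruence-≥-solution : ∀ a g .{{_ : NonZero g}} x y M → y ≡ x [mod gcd a g ] →
  ∃ λ ℓ → M ≤ ℓ × (y - x) ≡ + (ℓ ℕ.* a) [mod g ]
linear-congruence-≥-solution a g x y M y≡x =
  let L , g∣y-x-La = gcd∣⇒≡-multiple-mod a g (∣ᵤ⇒∣ {i = y - x} y≡x)
      ℓ , M≤ℓ , g∣ℓ-L = ∃-≥-≡-mod g M L
  in  ℓ , M≤ℓ , ≡-multiple-mod-trans (y - x) L g∣y-x-La g∣ℓ-L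

proposition3p2 : (n : ℕ) (S T : List ℕ) →
    NonemptySubsetOfBelow n S → NonemptySubsetOfBelow n T →
    WalkEnsured n S T →
    (u v : ℕ) → Vertex n u → Vertex n v →
    (+ u) ≡ (+ v) [mod gcdUnion S T ] →
    ∃ λ ℓ → Walk n S T u v ℓ
proposition3p2 n S T ((_ , s∈S) , S⊆[n-1]) ((t₀ , t₀∈T) , _) (M , _ , walk) u v u∈[n] v∈[n] u≡v =
  let ℓ , M≤ℓ , v-u≡ℓs₁ = linear-congruence-≥-solution s₁ g {{g≢0}} (+ u) (+ v) M
                            (≡-mod-∣ (+ v) (+ u) gcd[s₁,g]∣d (≡-mod-sym (+ u) (+ v) u≡v))
  in  ℓ , walk u v ℓ u∈[n] v∈[n] M≤ℓ v-u≡ℓs₁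
  where
  s₁ g : ℕ
  s₁ = minList S
  g  = gcdList (sumSet S T)

  s₁∈S : s₁ ∈ S
  s₁∈S = minList-∈ s∈S

  g≢0 : NonZero g
  g≢0 = gcdList-nonZero (∈-sumSet s₁∈S t₀∈T)
          {{>-nonZero (ℕ.≤-trans (proj₁ (All.lookup S⊆[n-1] s₁∈S)) (ℕ.m≤m+n s₁ t₀))}}

  gcd[s₁,g]∣d : gcd s₁ g ∣ gcdUnion S T
  gcd[s₁,g]∣d = ∣s∧∣gcd[S+T]⇒∣gcdUnion s₁∈S t₀∈T (gcd[m,n]∣m s₁ g) (gcd[m,n]∣n s₁ g)
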